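{- Let $M$ be a $0/\pm1$ matrix with an odd number of entries equal to $-1$, and suppose that $G(M)$ is a cycle. Form $M'$ from $M$ by replacing each entry $1$ by the $2\times2$ block $\begin{pmatrix}1&0\\0&1\end{pmatrix}$, each entry $-1$ by $\begin{pmatrix}0&-1\\-1&0\end{pmatrix}$, and each entry $0$ by the $2\times2$ zero block. Then $G(M')$ contains a unique cycle, whose length is twice the length of the cycle $G(M)$.
   Context: For an $r\times s$ matrix $M$ with entries in $\{0,1,-1\}$, the bipartite graph $G(M)$ has vertices $x_1,\dots,x_r,y_1,\dots,y_s$ and an edge $x_iy_j$ whenever $M_{i,j}\neq0$. "$G(M)$ is a cycle" means $G(M)$ is a single cycle graph (connected, every vertex of degree $2$). -}

module Defs where

open import Data.Nat using (ℕ; zero; suc; _+_; _*_)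
open import Data.Fin using (Fin; zero; suc; remQuot)
open import Data.Bool using (Bool; true; false; if_then_else_)
open import Data.Sum using (_⊎_; inj₁; inj₂)
open import Data.Product using (_×_; _,_; ∃-syntax)
open import Data.Empty using (⊥)
open import Relation.Binary.PropositionalEquality using (_≡_)
open import Relation.Binary.Construct.Closure.ReflexiveTransitive using (Star)

data Entry : Set where
  zer one neg : Entry

Matrix : ℕ → ℕ → Set
Matrix r s = Fin r → Fin s → Entry

isNZ : Entry → Bool
isNZ zer = false
isNZ one = true
isNZ neg = true

isNeg : Entry → Bool
isNeg neg = true
isNeg _   = false

count : ∀ {n} → (Fin n → Bool) → ℕ
count {zero}  p = 0
count {suc n} p = (if p zero then 1 else 0) + count (λ i → p (suc i))

countM : ∀ {r s} → (Fin r → Fin s → Bool) → ℕ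
countM {r} {s} E = go r E
  where
  go : ∀ k → (Fin k → Fin s → Bool) → ℕ
  go zero    E = 0
  go (suc k) E = count (E zero) + go k (λ i → E (suc i))

-- Bipartite graphs on x_1..x_r, y_1..y_s given by an edge set
-- E : Fin r → Fin s → Bool  (E i j = true iff x_i y_j is an edge).

Vertex : ℕ → ℕ → Set
Vertex r s = Fin r ⊎ Fin s

EdgeSet : ℕ → ℕ → Set
EdgeSet r s = Fin r → Fin s → Bool

Adj : ∀ {r s} → EdgeSet r s → Vertex r s → Vertex r s → Set
Adj E (inj₁ i) (inj₂ j) = E i j ≡ true
Adj E (inj₂ j) (inj₁ i) = E i j ≡ true
Adj E (inj₁ _) (inj₁ _) = ⊥
Adj E (inj₂ _) (inj₂ _) = ⊥

deg : ∀ {r s} → EdgeSet r s → Vertex r s → ℕ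
deg E (inj₁ i) = count (E i)
deg E (inj₂ j) = count (λ i → E i j)

numEdges : ∀ {r s} → EdgeSet r s → ℕ
numEdges = countM

IsCycleGraph : ∀ {r s} → EdgeSet r s → Set
IsCycleGraph {r} {s} E =
  (∃[ v ] (deg E v ≡ 2)) ×
  (∀ v → deg E v ≡ 2) ×
  (∀ u v → Star (Adj E) u v)

IsCycleIn : ∀ {r s} → EdgeSet r s → EdgeSet r s → Set
IsCycleIn {r} {s} E F =
  (∀ i j → F i j ≡ true → E i j ≡ true) ×
  (∃[ i ] ∃[ j ] (F i j ≡ true)) ×
  (∀ v → (deg F v ≡ 0) ⊎ (deg F v ≡ 2)) ×
  (∀ u v → deg F u ≡ 2 → deg F v ≡ 2 → Star (Adj F) u v)

G : ∀ {r s} → Matrix r s → EdgeSet r s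
G M i j = isNZ (M i j)

eqF2 : Fin 2 → Fin 2 → Bool
eqF2 zero zero = true
eqF2 (suc zero) (suc zero) = true
eqF2 _ _ = false

block : Entry → Fin 2 → Fin 2 → Entry
block zer a b = zer
block one a b = if eqF2 a b then one else zer
block neg a b = if eqF2 a b then zer else neg

-- Row 2i+a of M' (index combine i a) lies in block row i, offset a.
blowUp : ∀ {r s} → Matrix r s → Matrix (r * 2) (s * 2)
blowUp {r} {s} M i' j' with remQuot {r} 2 i' | remQuot {s} 2 j'
... | (i , a) | (j , b) = block (M i j) a b

{-# OPTIONS --safe #-}
module Submission where

-- G(M′) is the double cover of G(M) in which the edge x_i y_j joins sheet a over x_i to sheet
-- 'voltage (M i j) a' over y_j: the sheets are kept by an entry 1 and swapped by an entry -1.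
-- So G(M′) is 2-regular, and it is connected once some closed walk of G(M) changes sheet.
-- If none did, lifting walks from a base point would choose a sheet σ v over every vertex
-- consistently with all edges; the -1 entries would then be exactly the edges crossing the cut
-- {σ = 0} | {σ = 1}, and a cut is even when all degrees are even, contradicting oddness.
-- A connected 2-regular graph is its only cycle, and G(M′) has twice the vertices of the
-- 2-regular graph G(M), hence twice its edges.

open import Defs
open import Data.Nat using (ℕ; zero; suc; _+_; _*_; _%_; _≤_; z≤n; s≤s; parity)
open import Data.Nat.Properties using (*-comm; +-assoc; suc-injective; ≤-trans; n≤1+n; 1+n≰n; 1+n≢0)
open import Data.Fin using (Fin; zero; suc; combine; _↑ˡ_; _↑ʳ_; toℕ; opposite)
open import Data.Fin.Properties using (any?; combine-surjective; remQuot-combine) renaming (_≟_ to _≟ᶠ_)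
open import Data.Bool using (Bool; true; false; if_then_else_)
open import Data.Bool.Properties using () renaming (_≟_ to _≟ᵇ_)
open import Data.Parity using (Parity; 0ℙ; 1ℙ) renaming (_+_ to _⊕_; _*_ to _·_)
open import Data.Parity.Properties using (+-*-semiring; +-homo-+; *-distribˡ-+; p+p≡0ℙ)
open import Algebra.Properties.Semiring.Sum +-*-semiring
  using (sum-syntax; sum-cong-≗; sum-replicate-zero; ∑-distrib-+; ∑-comm; *-distribʳ-sum)
open import Data.Sum using (inj₁; inj₂)
open import Data.Product using (_×_; _,_; ∃-syntax; ∃₂)
open import Data.Empty using (⊥-elim)
open import Function using (flip)
open import Relation.Nullary using (yes; no; contradiction)
open import Relation.Nullary.Decidable using (_×-dec_; ¬?; decidable-stable)
open import Relation.Binary.PropositionalEquality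
open import Relation.Binary.Construct.Closure.ReflexiveTransitive using (Star; ε; _◅_; _◅◅_; reverse)

count-cong : ∀ {n} {p q : Fin n → Bool} → (∀ i → p i ≡ q i) → count p ≡ count q
count-cong {zero}  p≗q = refl
count-cong {suc n} p≗q =
  cong₂ (λ b c → (if b then 1 else 0) + c) (p≗q zero) (count-cong (λ i → p≗q (suc i)))

count-mono : ∀ {n} {p q : Fin n → Bool} → (∀ i → p i ≡ true → q i ≡ true) → count p ≤ count q
count-mono {zero} p⊆q = z≤n
count-mono {suc n} {p} {q} p⊆q with p zero in p₀ | q zero in q₀
... | true  | true  = s≤s (count-mono (λ i → p⊆q (suc i)))
... | false | false = count-mono (λ i → p⊆q (suc i))
... | false | true  = ≤-trans (count-mono (λ i → p⊆q (suc i))) (n≤1+n _)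
... | true  | false with () ← trans (sym q₀) (p⊆q zero p₀)

count-≡⇒≗ : ∀ {n} {p q : Fin n → Bool} → (∀ i → p i ≡ true → q i ≡ true) →
            count p ≡ count q → ∀ i → p i ≡ q i
count-≡⇒≗ {suc n} {p} {q} p⊆q eq i with p zero in p₀ | q zero in q₀
count-≡⇒≗ p⊆q eq zero    | true  | true  = trans p₀ (sym q₀)
count-≡⇒≗ p⊆q eq (suc i) | true  | true  = count-≡⇒≗ (λ i → p⊆q (suc i)) (suc-injective eq) i
count-≡⇒≗ p⊆q eq zero    | false | false = trans p₀ (sym q₀)
count-≡⇒≗ p⊆q eq (suc i) | false | false = count-≡⇒≗ (λ i → p⊆q (suc i)) eq i
count-≡⇒≗ p⊆q eq i       | true  | false with () ← trans (sym q₀) (p⊆q zero p₀)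
count-≡⇒≗ p⊆q eq i       | false | true  =
  ⊥-elim (1+n≰n (subst (_≤ _) eq (count-mono (λ i → p⊆q (suc i)))))

true⇒count≢0 : ∀ {n} {p : Fin n → Bool} i → p i ≡ true → count p ≢ 0
true⇒count≢0 {p = p} zero    pᵢ with p zero
true⇒count≢0         zero    () | false
true⇒count≢0         zero    pᵢ | true = λ ()
true⇒count≢0 {p = p} (suc i) pᵢ with p zero
... | true  = λ ()
... | false = true⇒count≢0 i pᵢ

count≢0⇒∃ : ∀ {n} {p : Fin n → Bool} → count p ≢ 0 → ∃[ i ] p i ≡ true
count≢0⇒∃ {zero}          c≢0 = ⊥-elim (c≢0 refl)
count≢0⇒∃ {suc n} {p = p} c≢0 with p zero in p₀
... | true  = zero , p₀
... | false with i , pᵢ ← count≢0⇒∃ c≢0 = suc i , pᵢ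

count-↑ : ∀ m {n} (p : Fin (m + n) → Bool) →
          count p ≡ count (λ i → p (i ↑ˡ n)) + count (λ i → p (m ↑ʳ i))
count-↑ zero    p = refl
count-↑ (suc m) p = trans (cong ((if p zero then 1 else 0) +_) (count-↑ m (λ i → p (suc i))))
                          (sym (+-assoc (if p zero then 1 else 0) _ _))

count-combine : ∀ {s k} (p : Fin (s * k) → Bool) (q : Fin s → Bool) →
                (∀ j → count (λ b → p (combine j b)) ≡ (if q j then 1 else 0)) → count p ≡ count q
count-combine {zero}      p q blocks = refl
count-combine {suc s} {k} p q blocks =
  trans (count-↑ k p)
        (cong₂ _+_ (blocks zero)
                   (count-combine (λ i → p (k ↑ʳ i)) (λ j → q (suc j)) (λ j → blocks (suc j))))

countM-rowRegular : ∀ {r s} (E : EdgeSet r s) d → (∀ i → count (E i) ≡ d) → countM E ≡ r * d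
countM-rowRegular {zero}  E d reg = refl
countM-rowRegular {suc r} E d reg =
  cong₂ _+_ (reg zero) (countM-rowRegular (λ i → E (suc i)) d (λ i → reg (suc i)))

_⊆_ : ∀ {r s} → EdgeSet r s → EdgeSet r s → Set
F ⊆ E = ∀ i j → F i j ≡ true → E i j ≡ true

module _ {r s : ℕ} where

  adj-sym : (E : EdgeSet r s) {x y : Vertex r s} → Adj E x y → Adj E y x
  adj-sym E {inj₁ i} {inj₂ j} e = e
  adj-sym E {inj₂ j} {inj₁ i} e = e

  adj⇒deg≢0 : (E : EdgeSet r s) {x y : Vertex r s} → Adj E x y → deg E x ≢ 0
  adj⇒deg≢0 E {inj₁ i} {inj₂ j} e = true⇒count≢0 j e
  adj⇒deg≢0 E {inj₂ j} {inj₁ i} e = true⇒count≢0 i e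

  deg≢0⇒edge : (E : EdgeSet r s) (x : Vertex r s) → deg E x ≢ 0 → ∃₂ λ i j → E i j ≡ true
  deg≢0⇒edge E (inj₁ i) d≢0 with j , e ← count≢0⇒∃ d≢0 = i , j , e
  deg≢0⇒edge E (inj₂ j) d≢0 with i , e ← count≢0⇒∃ d≢0 = i , j , e

  full-degree⇒adj : {E F : EdgeSet r s} → F ⊆ E → {x y : Vertex r s} →
                    deg F x ≡ deg E x → Adj E x y → Adj F x y
  full-degree⇒adj F⊆E {inj₁ i} {inj₂ j} d e = trans (count-≡⇒≗ (F⊆E i) d j) e
  full-degree⇒adj F⊆E {inj₂ j} {inj₁ i} d e = trans (count-≡⇒≗ (λ i → F⊆E i j) d i) e

  cycleGraph⇒isCycleIn-self : {E : EdgeSet r s} → IsCycleGraph E → IsCycleIn E E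
  cycleGraph⇒isCycleIn-self {E} ((v , d) , 2-regular , connected) =
    (λ _ _ e → e) , deg≢0⇒edge E v (λ d≡0 → 1+n≢0 (trans (sym d) d≡0)) ,
    (λ v → inj₂ (2-regular v)) , (λ u v _ _ → connected u v)

  cycleGraph-numEdges : {E : EdgeSet r s} → IsCycleGraph E → numEdges E ≡ r * 2
  cycleGraph-numEdges {E} (_ , 2-regular , _) = countM-rowRegular E 2 (λ i → 2-regular (inj₁ i))

  cycleGraph-uniqueCycle : {E F : EdgeSet r s} → IsCycleGraph E → IsCycleIn E F → ∀ i j → F i j ≡ E i j
  cycleGraph-uniqueCycle {E} {F} (_ , 2-regular , connected) (F⊆E , (i₀ , j₀ , f₀) , deg0or2 , _) i j =
    count-≡⇒≗ (F⊆E i) (trans (spread (connected (inj₁ i₀) (inj₁ i)) (touched {inj₁ i₀} {inj₂ j₀} f₀))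
                             (sym (2-regular (inj₁ i))))
              j
    where
    touched : ∀ {x y} → Adj F x y → deg F x ≡ 2
    touched {x} f with deg0or2 x
    ... | inj₁ d≡0 = ⊥-elim (adj⇒deg≢0 F f d≡0)
    ... | inj₂ d≡2 = d≡2
    spread : ∀ {x y} → Star (Adj E) x y → deg F x ≡ 2 → deg F y ≡ 2
    spread ε       d = d
    spread {x} (_◅_ {j = y} e p) d =
      spread p (touched {y} {x} (adj-sym F (full-degree⇒adj F⊆E (trans d (sym (2-regular x))) e)))

EvenDegrees : ∀ {r s} → EdgeSet r s → Set
EvenDegrees E = ∀ v → parity (deg E v) ≡ 0ℙ

χ : Bool → Parity
χ b = parity (if b then 1 else 0)

parity-count : ∀ {n} (p : Fin n → Bool) → parity (count p) ≡ ∑[ i < n ] χ (p i)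
parity-count {zero}  p = refl
parity-count {suc n} p = trans (+-homo-+ (if p zero then 1 else 0) (count (λ i → p (suc i))))
                               (cong (χ (p zero) ⊕_) (parity-count (λ i → p (suc i))))

parity-countM : ∀ {r s} (E : EdgeSet r s) → parity (countM E) ≡ ∑[ i < r ] ∑[ j < s ] χ (E i j)
parity-countM {zero}  E = refl
parity-countM {suc r} E = trans (+-homo-+ (count (E zero)) (countM (λ i → E (suc i))))
                                (cong₂ _⊕_ (parity-count (E zero)) (parity-countM (λ i → E (suc i))))

%2≡1⇒parity≡1ℙ : ∀ n → n % 2 ≡ 1 → parity n ≡ 1ℙ
%2≡1⇒parity≡1ℙ (suc zero)    _   = refl
%2≡1⇒parity≡1ℙ (suc (suc n)) odd = %2≡1⇒parity≡1ℙ n odd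

evenRows⇒∑∑-rowWeighted≡0 : ∀ {r s} (E : EdgeSet r s) → (∀ i → parity (count (E i)) ≡ 0ℙ) →
                            (x : Fin r → Parity) → ∑[ i < r ] ∑[ j < s ] (χ (E i j) · x i) ≡ 0ℙ
evenRows⇒∑∑-rowWeighted≡0 {r} {s} E even x = begin
  ∑[ i < r ] ∑[ j < s ] (χ (E i j) · x i)
    ≡⟨ sum-cong-≗ (λ i → sym (*-distribʳ-sum (x i) (λ j → χ (E i j)))) ⟩
  ∑[ i < r ] ((∑[ j < s ] χ (E i j)) · x i)
    ≡⟨ sum-cong-≗ (λ i → cong (_· x i) (trans (sym (parity-count (E i))) (even i))) ⟩
  ∑[ i < r ] 0ℙ
    ≡⟨ sum-replicate-zero r ⟩
  0ℙ
    ∎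
  where open ≡-Reasoning

evenDegrees⇒evenCut : ∀ {r s} (E : EdgeSet r s) → EvenDegrees E →
                      (x : Fin r → Parity) (y : Fin s → Parity) →
                      ∑[ i < r ] ∑[ j < s ] (χ (E i j) · (x i ⊕ y j)) ≡ 0ℙ
evenDegrees⇒evenCut {r} {s} E even x y = begin
  ∑[ i < r ] ∑[ j < s ] (χ (E i j) · (x i ⊕ y j))
    ≡⟨ sum-cong-≗ (λ i → trans (sum-cong-≗ (λ j → *-distribˡ-+ (χ (E i j)) (x i) (y j)))
                                 (∑-distrib-+ (λ j → χ (E i j) · x i) (λ j → χ (E i j) · y j))) ⟩
  ∑[ i < r ] (∑[ j < s ] (χ (E i j) · x i) ⊕ ∑[ j < s ] (χ (E i j) · y j))
    ≡⟨ ∑-distrib-+ (λ i → ∑[ j < s ] (χ (E i j) · x i)) (λ i → ∑[ j < s ] (χ (E i j) · y j)) ⟩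
  ∑[ i < r ] ∑[ j < s ] (χ (E i j) · x i) ⊕ ∑[ i < r ] ∑[ j < s ] (χ (E i j) · y j)
    ≡⟨ cong₂ _⊕_ (evenRows⇒∑∑-rowWeighted≡0 E (λ i → even (inj₁ i)) x)
                 (trans (∑-comm (λ i j → χ (E i j) · y j))
                        (evenRows⇒∑∑-rowWeighted≡0 (flip E) (λ j → even (inj₂ j)) y)) ⟩
  0ℙ
    ∎
  where open ≡-Reasoning

voltage : Entry → Fin 2 → Fin 2
voltage zer a = a
voltage one a = a
voltage neg a = opposite a

voltage-opposite : ∀ e a → voltage e (opposite a) ≡ opposite (voltage e a)
voltage-opposite zer a = refl
voltage-opposite one a = refl
voltage-opposite neg a = refl

≢⇒≡opposite : {a b : Fin 2} → a ≢ b → a ≡ opposite b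
≢⇒≡opposite {zero}     {zero}     a≢b = ⊥-elim (a≢b refl)
≢⇒≡opposite {zero}     {suc zero} a≢b = refl
≢⇒≡opposite {suc zero} {zero}     a≢b = refl
≢⇒≡opposite {suc zero} {suc zero} a≢b = ⊥-elim (a≢b refl)

block-voltage : ∀ e a → isNZ e ≡ true → isNZ (block e a (voltage e a)) ≡ true
block-voltage one zero       _ = refl
block-voltage one (suc zero) _ = refl
block-voltage neg zero       _ = refl
block-voltage neg (suc zero) _ = refl

block-voltageᵀ : ∀ e a → isNZ e ≡ true → isNZ (block e (voltage e a) a) ≡ true
block-voltageᵀ one zero       _ = refl
block-voltageᵀ one (suc zero) _ = refl
block-voltageᵀ neg zero       _ = refl
block-voltageᵀ neg (suc zero) _ = refl

count-blockRow : ∀ e a → count (λ b → isNZ (block e a b)) ≡ (if isNZ e then 1 else 0)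
count-blockRow zer a          = refl
count-blockRow one zero       = refl
count-blockRow one (suc zero) = refl
count-blockRow neg zero       = refl
count-blockRow neg (suc zero) = refl

count-blockColumn : ∀ e b → count (λ a → isNZ (block e a b)) ≡ (if isNZ e then 1 else 0)
count-blockColumn zer b          = refl
count-blockColumn one zero       = refl
count-blockColumn one (suc zero) = refl
count-blockColumn neg zero       = refl
count-blockColumn neg (suc zero) = refl

χ-isNeg-consistent : ∀ e a b → (isNZ e ≡ true → voltage e a ≡ b) →
                     χ (isNeg e) ≡ χ (isNZ e) · (parity (toℕ a) ⊕ parity (toℕ b))
χ-isNeg-consistent zer a b consistent = refl
χ-isNeg-consistent one a b consistent with refl ← consistent refl = sym (p+p≡0ℙ (parity (toℕ a)))
χ-isNeg-consistent neg a b consistent with refl ← consistent refl = opposite-parity a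
  where opposite-parity : ∀ a → 1ℙ ≡ parity (toℕ a) ⊕ parity (toℕ (opposite a))
        opposite-parity zero       = refl
        opposite-parity (suc zero) = refl

negatives : ∀ {r s} → Matrix r s → ℕ
negatives M = countM (λ i j → isNeg (M i j))

lift : ∀ {r s} → Vertex r s → Fin 2 → Vertex (r * 2) (s * 2)
lift (inj₁ i) a = inj₁ (combine i a)
lift (inj₂ j) a = inj₂ (combine j a)

lift-surjective : ∀ {r s} (x : Vertex (r * 2) (s * 2)) → ∃₂ λ v a → lift {r} {s} v a ≡ x
lift-surjective {r} {s} (inj₁ i′) with i , a , eq ← combine-surjective {r} i′ = inj₁ i , a , cong inj₁ eq
lift-surjective {r} {s} (inj₂ j′) with j , b , eq ← combine-surjective {s} j′ = inj₂ j , b , cong inj₂ eq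

module _ {r s : ℕ} (M : Matrix r s) where

  infix 4 _⇝_
  _⇝_ : Vertex (r * 2) (s * 2) → Vertex (r * 2) (s * 2) → Set
  _⇝_ = Star (Adj (G (blowUp M)))

  blowUp-combine : ∀ i a j b → blowUp M (combine i a) (combine j b) ≡ block (M i j) a b
  blowUp-combine i a j b = cong₂ (λ (i , a) (j , b) → block (M i j) a b)
                                 (remQuot-combine {r} {2} i a) (remQuot-combine {s} {2} j b)

  deg-lift : ∀ v a → deg (G (blowUp M)) (lift v a) ≡ deg (G M) v
  deg-lift (inj₁ i) a = count-combine _ (G M i) λ j →
    trans (count-cong (λ b → cong isNZ (blowUp-combine i a j b))) (count-blockRow (M i j) a)
  deg-lift (inj₂ j) b = count-combine _ (λ i → G M i j) λ i →
    trans (count-cong (λ a → cong isNZ (blowUp-combine i a j b))) (count-blockColumn (M i j) b)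

  edgeEntry : Vertex r s → Vertex r s → Entry
  edgeEntry (inj₁ i) (inj₂ j) = M i j
  edgeEntry (inj₂ j) (inj₁ i) = M i j
  edgeEntry _        _        = zer

  lift-adj : ∀ {u v} → Adj (G M) u v → ∀ a →
             Adj (G (blowUp M)) (lift u a) (lift v (voltage (edgeEntry u v) a))
  lift-adj {inj₁ i} {inj₂ j} e a = trans (cong isNZ (blowUp-combine i a j _)) (block-voltage (M i j) a e)
  lift-adj {inj₂ j} {inj₁ i} e b = trans (cong isNZ (blowUp-combine i _ j b)) (block-voltageᵀ (M i j) b e)

  endpoint : ∀ {u v} → Star (Adj (G M)) u v → Fin 2 → Fin 2
  endpoint ε                        a = a
  endpoint (_◅_ {i = u} {j = w} _ p) a = endpoint p (voltage (edgeEntry u w) a)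

  liftPath : ∀ {u v} (p : Star (Adj (G M)) u v) a → lift u a ⇝ lift v (endpoint p a)
  liftPath ε       a = ε
  liftPath (e ◅ p) a = lift-adj e a ◅ liftPath p _

  endpoint-opposite : ∀ {u v} (p : Star (Adj (G M)) u v) a →
                      endpoint p (opposite a) ≡ opposite (endpoint p a)
  endpoint-opposite ε                        a = refl
  endpoint-opposite (_◅_ {i = u} {j = w} _ p) a =
    trans (cong (endpoint p) (voltage-opposite (edgeEntry u w) a)) (endpoint-opposite p _)

  Consistent : (Vertex r s → Fin 2) → Set
  Consistent σ = ∀ i j → isNZ (M i j) ≡ true → voltage (M i j) (σ (inj₁ i)) ≡ σ (inj₂ j)

  consistent⇒evenNegatives : EvenDegrees (G M) → ∀ σ → Consistent σ → parity (negatives M) ≡ 0ℙ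
  consistent⇒evenNegatives even σ consistent = begin
    parity (negatives M)
      ≡⟨ parity-countM (λ i j → isNeg (M i j)) ⟩
    ∑[ i < r ] ∑[ j < s ] χ (isNeg (M i j))
      ≡⟨ sum-cong-≗ (λ i → sum-cong-≗ (λ j →
           χ-isNeg-consistent (M i j) (σ (inj₁ i)) (σ (inj₂ j)) (consistent i j))) ⟩
    ∑[ i < r ] ∑[ j < s ] (χ (G M i j) · (ℓ (inj₁ i) ⊕ ℓ (inj₂ j)))
      ≡⟨ evenDegrees⇒evenCut (G M) even (λ i → ℓ (inj₁ i)) (λ j → ℓ (inj₂ j)) ⟩
    0ℙ ∎
    where open ≡-Reasoning
          ℓ : Vertex r s → Parity
          ℓ v = parity (toℕ (σ v))

  oddNegatives⇒inconsistent : EvenDegrees (G M) → parity (negatives M) ≡ 1ℙ → ∀ σ →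
                              ∃₂ λ i j → isNZ (M i j) ≡ true × voltage (M i j) (σ (inj₁ i)) ≢ σ (inj₂ j)
  oddNegatives⇒inconsistent even odd σ
    with any? (λ i → any? λ j →
                 (isNZ (M i j) ≟ᵇ true) ×-dec ¬? (voltage (M i j) (σ (inj₁ i)) ≟ᶠ σ (inj₂ j)))
  ... | yes inconsistency = inconsistency
  ... | no none = contradiction (trans (sym odd) (consistent⇒evenNegatives even σ consistent)) λ ()
    where consistent : Consistent σ
          consistent i j nz = decidable-stable (_ ≟ᶠ _) (λ ≢ → none (i , j , nz , ≢))

  module _ (connected : ∀ u v → Star (Adj (G M)) u v) where

    twistedFibre : Vertex r s → EvenDegrees (G M) → parity (negatives M) ≡ 1ℙ →
                   ∃₂ λ (w : Vertex r s) c → lift w c ⇝ lift w (opposite c)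
    twistedFibre v₀ even odd =
      let i , j , nz , twisted = oddNegatives⇒inconsistent even odd σ in
      inj₂ j , σ (inj₂ j) ,
      subst (λ c → lift {r} (inj₂ j) (σ (inj₂ j)) ⇝ lift {r} (inj₂ j) c) (≢⇒≡opposite twisted)
            (reverse (adj-sym (G (blowUp M))) (over (inj₂ j)) ◅◅ over (inj₁ i) ◅◅
             lift-adj {inj₁ i} {inj₂ j} nz (σ (inj₁ i)) ◅ ε)
      where
      σ : Vertex r s → Fin 2
      σ v = endpoint (connected v₀ v) zero
      over : ∀ v → lift v₀ zero ⇝ lift v (σ v)
      over v = liftPath (connected v₀ v) zero

    twistedFibre⇒reachesAll : ∀ {w c} → lift w c ⇝ lift w (opposite c) → ∀ x → lift w c ⇝ x
    twistedFibre⇒reachesAll {w} {c} twist x with v , a , refl ← lift-surjective {r} {s} x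
      with endpoint (connected w v) c ≟ᶠ a
    ... | yes refl = liftPath (connected w v) c
    ... | no ≢a = subst (λ b → lift w c ⇝ lift v b)
                        (trans (endpoint-opposite (connected w v) c) (sym (≢⇒≡opposite (≢-sym ≢a))))
                        (twist ◅◅ liftPath (connected w v) (opposite c))

    blowUp-connected : Vertex r s → EvenDegrees (G M) → parity (negatives M) ≡ 1ℙ → ∀ x y → x ⇝ y
    blowUp-connected v₀ even odd x y with w , c , twist ← twistedFibre v₀ even odd =
      reverse (adj-sym (G (blowUp M))) (twistedFibre⇒reachesAll twist x) ◅◅ twistedFibre⇒reachesAll twist y

blowUp-isCycleGraph : ∀ {r s} (M : Matrix r s) → parity (negatives M) ≡ 1ℙ →
                      IsCycleGraph (G M) → IsCycleGraph (G (blowUp M))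
blowUp-isCycleGraph {r} {s} M odd ((v₀ , d₀) , 2-regular , connected) =
  (lift v₀ zero , trans (deg-lift M v₀ zero) d₀) , 2-regular′ , blowUp-connected M connected v₀ even odd
  where
  even : EvenDegrees (G M)
  even v = cong parity (2-regular v)
  2-regular′ : ∀ x → deg (G (blowUp M)) x ≡ 2
  2-regular′ x with v , a , refl ← lift-surjective {r} {s} x = trans (deg-lift M v a) (2-regular v)

proposition4p1 : (r s : ℕ) (M : Matrix r s) →
    countM (λ i j → isNeg (M i j)) % 2 ≡ 1 →
    IsCycleGraph (G M) →
    ∃[ F ] (IsCycleIn (G (blowUp M)) F ×
            (∀ F′ → IsCycleIn (G (blowUp M)) F′ → ∀ i j → F′ i j ≡ F i j) ×
            numEdges F ≡ 2 * numEdges (G M))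
proposition4p1 r s M odd cycle =
  G (blowUp M) ,
  cycleGraph⇒isCycleIn-self lifted ,
  (λ _ → cycleGraph-uniqueCycle lifted) ,
  trans (cycleGraph-numEdges lifted) (trans (*-comm (r * 2) 2) (cong (2 *_) (sym (cycleGraph-numEdges cycle))))
  where
  lifted : IsCycleGraph (G (blowUp M))
  lifted = blowUp-isCycleGraph M (%2≡1⇒parity≡1ℙ (negatives M) odd) cycle
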